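{- Let $t_n=(-1)^{s_2(n)}$, $h_0=0$, $h_1=1$, and $h_n=t_nh_{n-1}+h_{n-2}$ for $n\ge2$. For $n\in\mathbb{N}$ we have $$\sum_{i=1}^{n}t_ih_{2i-1}=h_{2n},\qquad \sum_{i=1}^{n}t_ih_{2i}=1-h_{2n+1}.$$
   Context: $s_2(n)$ denotes the number of 1's in the binary expansion of $n$; $(t_n)$ is the Prouhet–Thue–Morse sequence. -}

module Defs where

open import Data.Nat using (ℕ; zero; suc; _%_; _/_; _∸_)
open import Data.Integer using (ℤ; +_; -_; _+_; _*_)

-- number of 1's in the binary expansion of n, computed with fuel;
-- fuel ≥ n suffices (each step halves n)
s₂-aux : ℕ → ℕ → ℕ
s₂-aux zero    n = 0
s₂-aux (suc f) n = (n % 2) Data.Nat.+ s₂-aux f (n / 2)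

s₂ : ℕ → ℕ
s₂ n = s₂-aux n n

sign : ℕ → ℤ
sign zero    = + 1
sign (suc k) = - sign k

t : ℕ → ℤ
t n = sign (s₂ n)

h : ℕ → ℤ
h zero          = + 0
h (suc zero)    = + 1
h (suc (suc n)) = t (suc (suc n)) * h (suc n) + h n

Σ₁ : ℕ → (ℕ → ℤ) → ℤ
Σ₁ zero    f = + 0
Σ₁ (suc n) f = Σ₁ n f + f (suc n)

-- The parity lemmas t(2m) = t m and t(2m+1) = -t m turn the recurrence of h at the
-- indices 2n+2 and 2n+3 into h(2n+2) = t(n+1) h(2n+1) + h(2n) and
-- h(2n+3) = -t(n+1) h(2n+2) + h(2n+1), i.e. the new summand of each sum is exactly
-- the increment of its closed form; both identities then follow by induction on n.
module Submission where

open import Defs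
open import Data.Nat using (ℕ)
open import Data.Integer using (+_; _*_; _-_)
open import Data.Product using (_×_)
open import Relation.Binary.PropositionalEquality using (_≡_)

import Data.Nat as ℕ
open import Data.Nat using (zero; suc; _≤_; z≤n; s≤s; _%_; _/_)
open import Data.Nat.Properties using (≤-trans; ≤-pred; ≤-refl; n≤1+n; m≤m*n; m≤n+m; *-comm; *-suc)
open import Data.Nat.DivMod using (m/n<m; [m+kn]%n≡m%n; m<n⇒m%n≡m; m<n⇒m/n≡0; m*n/n≡m; +-distrib-/-∣ʳ)
open import Data.Nat.Divisibility using (divides-refl)
open import Data.Integer using (-_; _+_)
open import Data.Integer.Properties using (+-comm)
open import Data.Integer.Tactic.RingSolver using (solve-∀)
open import Data.Product using (_,_)
open import Function using (_∘_)
open import Relation.Binary.PropositionalEquality using (refl; sym; trans; cong; cong₂; module ≡-Reasoning)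

half-≤ : ∀ {n f} → n ≤ suc f → n / 2 ≤ f
half-≤ {zero}  _         = z≤n
half-≤ {suc n} (s≤s n≤f) = ≤-trans (≤-pred (m/n<m (suc n) 2 (s≤s (s≤s z≤n)))) n≤f

s₂-aux-zero : ∀ f → s₂-aux f 0 ≡ 0
s₂-aux-zero zero    = refl
s₂-aux-zero (suc f) = s₂-aux-zero f

s₂-aux-fuel-irrelevant : ∀ {f g} n → n ≤ f → n ≤ g → s₂-aux f n ≡ s₂-aux g n
s₂-aux-fuel-irrelevant {zero}  {g}     .zero z≤n _   = sym (s₂-aux-zero g)
s₂-aux-fuel-irrelevant {suc f} {zero}  .zero _   z≤n = s₂-aux-zero (suc f)
s₂-aux-fuel-irrelevant {suc f} {suc g} n     n≤f n≤g =
  cong (n % 2 ℕ.+_) (s₂-aux-fuel-irrelevant (n / 2) (half-≤ n≤f) (half-≤ n≤g))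

-- Unfolding s₂ n with fuel 1 + n reads off the last digit in one step.
s₂-append-digit : ∀ b m → b ℕ.< 2 → s₂ (b ℕ.+ m ℕ.* 2) ≡ b ℕ.+ s₂ m
s₂-append-digit b m b<2 = begin
  s₂ n                                  ≡⟨ s₂-aux-fuel-irrelevant n ≤-refl (n≤1+n n) ⟩
  n % 2 ℕ.+ s₂-aux n (n / 2)            ≡⟨ cong₂ ℕ._+_ digit (cong (s₂-aux n) quotient) ⟩
  b ℕ.+ s₂-aux n m                      ≡⟨ cong (b ℕ.+_) (s₂-aux-fuel-irrelevant m (m≤b+m*2) ≤-refl) ⟩
  b ℕ.+ s₂ m                            ∎
  where
  open ≡-Reasoning
  n : ℕ
  n = b ℕ.+ m ℕ.* 2
  digit : n % 2 ≡ b
  digit = trans ([m+kn]%n≡m%n b m 2) (m<n⇒m%n≡m b<2)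
  quotient : n / 2 ≡ m
  quotient = begin
    n / 2                   ≡⟨ +-distrib-/-∣ʳ b (divides-refl m) ⟩
    b / 2 ℕ.+ m ℕ.* 2 / 2   ≡⟨ cong₂ ℕ._+_ (m<n⇒m/n≡0 b<2) (m*n/n≡m m 2) ⟩
    m                       ∎
  m≤b+m*2 : m ≤ n
  m≤b+m*2 = ≤-trans (m≤m*n m 2) (m≤n+m (m ℕ.* 2) b)

t-double : ∀ m → t (2 ℕ.* m) ≡ t m
t-double m = cong sign (trans (cong s₂ (*-comm 2 m)) (s₂-append-digit 0 m (s≤s z≤n)))

t-suc-double : ∀ m → t (suc (2 ℕ.* m)) ≡ - t m
t-suc-double m = cong sign (trans (cong (s₂ ∘ suc) (*-comm 2 m)) (s₂-append-digit 1 m ≤-refl))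

h-double-suc : ∀ n → h (2 ℕ.* suc n) ≡ t (suc n) * h (suc (2 ℕ.* n)) + h (2 ℕ.* n)
h-double-suc n = begin
  h (2 ℕ.* suc n)
    ≡⟨ cong h (*-suc 2 n) ⟩
  t (2 ℕ.+ 2 ℕ.* n) * h (suc (2 ℕ.* n)) + h (2 ℕ.* n)
    ≡⟨ cong (λ τ → τ * h (suc (2 ℕ.* n)) + h (2 ℕ.* n)) t-index ⟩
  t (suc n) * h (suc (2 ℕ.* n)) + h (2 ℕ.* n) ∎
  where
  open ≡-Reasoning
  t-index : t (2 ℕ.+ 2 ℕ.* n) ≡ t (suc n)
  t-index = trans (cong t (sym (*-suc 2 n))) (t-double (suc n))

h-suc-double-suc : ∀ n → h (suc (2 ℕ.* suc n)) ≡ - t (suc n) * h (2 ℕ.* suc n) + h (suc (2 ℕ.* n))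
h-suc-double-suc n = begin
  h (suc (2 ℕ.* suc n))
    ≡⟨ cong (h ∘ suc) (*-suc 2 n) ⟩
  t (3 ℕ.+ 2 ℕ.* n) * h (2 ℕ.+ 2 ℕ.* n) + h (suc (2 ℕ.* n))
    ≡⟨ cong₂ (λ τ η → τ * η + h (suc (2 ℕ.* n))) t-index (cong h (sym (*-suc 2 n))) ⟩
  - t (suc n) * h (2 ℕ.* suc n) + h (suc (2 ℕ.* n)) ∎
  where
  open ≡-Reasoning
  t-index : t (3 ℕ.+ 2 ℕ.* n) ≡ - t (suc n)
  t-index = trans (cong (t ∘ suc) (sym (*-suc 2 n))) (t-suc-double (suc n))

Σ₁-t*h-odd : ∀ n → Σ₁ n (λ i → t i * h (2 ℕ.* i ℕ.∸ 1)) ≡ h (2 ℕ.* n)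
Σ₁-t*h-odd zero    = refl
Σ₁-t*h-odd (suc n) = begin
  Σ₁ n (λ i → t i * h (2 ℕ.* i ℕ.∸ 1)) + t (suc n) * h (2 ℕ.* suc n ℕ.∸ 1)
    ≡⟨ cong₂ _+_ (Σ₁-t*h-odd n) (cong (λ k → t (suc n) * h (k ℕ.∸ 1)) (*-suc 2 n)) ⟩
  h (2 ℕ.* n) + t (suc n) * h (suc (2 ℕ.* n))
    ≡⟨ +-comm (h (2 ℕ.* n)) _ ⟩
  t (suc n) * h (suc (2 ℕ.* n)) + h (2 ℕ.* n)
    ≡⟨ sym (h-double-suc n) ⟩
  h (2 ℕ.* suc n) ∎
  where open ≡-Reasoning

Σ₁-t*h-even : ∀ n → Σ₁ n (λ i → t i * h (2 ℕ.* i)) ≡ + 1 - h (suc (2 ℕ.* n))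
Σ₁-t*h-even zero    = refl
Σ₁-t*h-even (suc n) = begin
  Σ₁ n (λ i → t i * h (2 ℕ.* i)) + t (suc n) * h (2 ℕ.* suc n)
    ≡⟨ cong (_+ t (suc n) * h (2 ℕ.* suc n)) (Σ₁-t*h-even n) ⟩
  + 1 - h (suc (2 ℕ.* n)) + t (suc n) * h (2 ℕ.* suc n)
    ≡⟨ rearrange (+ 1) (h (suc (2 ℕ.* n))) (t (suc n)) (h (2 ℕ.* suc n)) ⟩
  + 1 - (- t (suc n) * h (2 ℕ.* suc n) + h (suc (2 ℕ.* n)))
    ≡⟨ cong (_-_ (+ 1)) (sym (h-suc-double-suc n)) ⟩
  + 1 - h (suc (2 ℕ.* suc n)) ∎
  where
  open ≡-Reasoning
  rearrange : ∀ x a b c → x - a + b * c ≡ x - (- b * c + a)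
  rearrange = solve-∀

lemma4 : (n : ℕ) →
    (Σ₁ n (λ i → t i * h (2 Data.Nat.* i Data.Nat.∸ 1)) ≡ h (2 Data.Nat.* n))
    × (Σ₁ n (λ i → t i * h (2 Data.Nat.* i)) ≡ + 1 - h (Data.Nat.suc (2 Data.Nat.* n)))
lemma4 n = Σ₁-t*h-odd n , Σ₁-t*h-even n
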